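{- Let $a_0,b_0,c_0,d_0$ be constants and define sequences recursively by \begin{align*} a_{n+1}&=\frac{a_{n}^2 -a_n c_n - a_n d_n}{a_n-c_n}, & b_{n+1}&=b_{n},\\ c_{n+1}&=\frac {a_nc_n-2a_nd_n-c_n^{2}}{a_n-c_n}, & d_{n+1}&=\frac {a_nd_n}{a_n-c_n}, \end{align*} and set $\hat a_k=a_k-c_k$. Let $\alpha=a_0(c_0+d_0-a_0)$, $\beta=c_0-2a_0$, and define $B_n$ by $B_0=1$, $B_1=c_0-a_0$, $B_{n+1}=\beta B_n+\alpha B_{n-1}$ for $n\ge1$. Let $n\ge0$, suppose $a_k\neq0$ and $\hat a_k\neq0$ for all $k\le n$, and suppose $B_1,\dots,B_{n+1}\neq0$. Then \[ a_{n+1}=\frac{\alpha B_n}{B_{n+1}},\qquad \hat a_{n+1}=-\frac{B_{n+2}}{B_{n+1}}. \] -}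

module Defs where

open import Level using (Level; _⊔_) renaming (suc to lsuc)
open import Data.Nat using (ℕ; zero; suc)
open import Data.Product using (_×_; _,_)
open import Relation.Nullary using (¬_)
open import Algebra.Bundles using (CommutativeRing)

-- A field: a commutative ring with a (total) inverse operation which is a
-- genuine multiplicative inverse on nonzero elements (0⁻¹ is fixed to 0, the
-- usual convention making division total; it never matters under the
-- nonvanishing hypotheses of the theorem), and 1 ≠ 0.
record Field (c ℓ : Level) : Set (lsuc (c ⊔ ℓ)) where
  field
    commutativeRing : CommutativeRing c ℓ
  open CommutativeRing commutativeRing public
  field
    _⁻¹     : Carrier → Carrier
    ⁻¹-cong : ∀ {x y} → x ≈ y → x ⁻¹ ≈ y ⁻¹
    *-inverseʳ : ∀ x → ¬ (x ≈ 0#) → (x * (x ⁻¹)) ≈ 1#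
    0⁻¹≈0   : (0# ⁻¹) ≈ 0#
    1≉0     : ¬ (1# ≈ 0#)

  infixl 7 _/_
  _/_ : Carrier → Carrier → Carrier
  x / y = x * (y ⁻¹)

module Seq {ℓ₁ ℓ₂ : Level} (F : Field ℓ₁ ℓ₂) (a₀ b₀ c₀ d₀ : Field.Carrier F) where
  open Field F

  Quad : Set ℓ₁
  Quad = Carrier × Carrier × Carrier × Carrier

  step : Quad → Quad
  step (a , b , c , d) =
    ( (a * a - a * c - a * d) / (a - c)
    , b
    , (a * c - 2a*d - c * c) / (a - c)
    , (a * d) / (a - c) )
    where 2a*d = (1# + 1#) * a * d

  quad : ℕ → Quad
  quad zero    = (a₀ , b₀ , c₀ , d₀)
  quad (suc n) = step (quad n)

  a b c d â : ℕ → Carrier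
  a n with quad n
  ... | (x , _ , _ , _) = x
  b n with quad n
  ... | (_ , x , _ , _) = x
  c n with quad n
  ... | (_ , _ , x , _) = x
  d n with quad n
  ... | (_ , _ , _ , x) = x
  â k = a k - c k

  α β : Carrier
  α = a₀ * (c₀ + d₀ - a₀)
  β = c₀ - (1# + 1#) * a₀

  B : ℕ → Carrier
  B zero = 1#
  B (suc zero) = c₀ - a₀
  B (suc (suc n)) = β * B (suc n) + α * B n

{-# OPTIONS --safe #-}
module Submission where

-- With â_k ≠ 0, one step of the recursion preserves α_k = a_k (c_k + d_k − a_k)
-- and β_k = c_k − 2 a_k, and satisfies a_{k+1} (c_k − a_k) = α_k. Since moreover
-- c_k − a_k = β_k + a_k, a simultaneous induction gives B_{k+1} = (c_k − a_k) B_k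
-- and a_{k+1} B_{k+1} = α B_k; dividing by B_{n+1} yields both formulas.

open import Defs
open import Algebra.Bundles using (CommutativeRing)
open import Data.Integer.Base as ℤ using (ℤ; +_; -[1+_]; _⊖_; _◃_; +-*-rawRing)
import Data.Integer.Properties as ℤ
open import Data.Maybe.Base using (Maybe; just; nothing)
open import Data.Nat.Base as ℕ using (ℕ; zero; suc; _≤_; _<_; s≤s; z≤n)
import Data.Nat.Properties as ℕ
open import Data.Product.Base using (_×_; _,_)
open import Data.Sign.Base as Sign using ()
import Relation.Binary.PropositionalEquality.Core as ≡
open import Relation.Nullary using (¬_; yes; no)

-- Algebra.Solver.Ring needs a coefficient ring mapped homomorphically into R;
-- for an arbitrary commutative ring the canonical choice is ℤ.
module IntegerCoefficientRingSolver {c ℓ} (R : CommutativeRing c ℓ) where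
  open CommutativeRing R
  open import Algebra.Properties.Ring ring
    using (-0#≈0#; -‿involutive; -‿+-comm; -‿distribˡ-*; -‿distribʳ-*)
  open import Algebra.Properties.CommutativeSemigroup +-commutativeSemigroup
    using (interchange)
  open import Algebra.Properties.Semiring.Mult.TCOptimised semiring
    using (×-homo-+; ×1-homo-*) renaming (_×_ to _×ₙ_)
  open import Algebra.Solver.Ring.AlmostCommutativeRing
    using (fromCommutativeRing; _-Raw-AlmostCommutative⟶_)
  open import Relation.Binary.Reasoning.Setoid setoid

  fromℕ : ℕ → Carrier
  fromℕ n = n ×ₙ 1#

  fromℤ : ℤ → Carrier
  fromℤ (+ n)    = fromℕ n
  fromℤ -[1+ n ] = - fromℕ (suc n)

  fromℕ-suc : ∀ n → fromℕ (suc n) ≈ 1# + fromℕ n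
  fromℕ-suc = ×-homo-+ 1# 1

  [x+y]-[x+z]≈y-z : ∀ x y z → (x + y) - (x + z) ≈ y - z
  [x+y]-[x+z]≈y-z x y z = begin
    (x + y) + - (x + z)   ≈⟨ +-congˡ (-‿+-comm x z) ⟨
    (x + y) + (- x + - z) ≈⟨ interchange x y (- x) (- z) ⟩
    (x - x) + (y - z)     ≈⟨ +-congʳ (-‿inverseʳ x) ⟩
    0# + (y - z)          ≈⟨ +-identityˡ _ ⟩
    y - z                 ∎

  fromℤ-⊖ : ∀ m n → fromℤ (m ⊖ n) ≈ fromℕ m - fromℕ n
  fromℤ-⊖ zero    zero    = sym (-‿inverseʳ 0#)
  fromℤ-⊖ (suc m) zero    = sym (trans (+-congˡ -0#≈0#) (+-identityʳ _))
  fromℤ-⊖ zero    (suc n) = sym (+-identityˡ _)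
  fromℤ-⊖ (suc m) (suc n) = begin
    fromℤ (suc m ⊖ suc n)               ≡⟨ ≡.cong fromℤ (ℤ.[1+m]⊖[1+n]≡m⊖n m n) ⟩
    fromℤ (m ⊖ n)                       ≈⟨ fromℤ-⊖ m n ⟩
    fromℕ m - fromℕ n                   ≈⟨ [x+y]-[x+z]≈y-z 1# (fromℕ m) (fromℕ n) ⟨
    (1# + fromℕ m) - (1# + fromℕ n)     ≈⟨ +-cong (fromℕ-suc m) (-‿cong (fromℕ-suc n)) ⟨
    fromℕ (suc m) - fromℕ (suc n)       ∎

  fromℤ-+ : ∀ i j → fromℤ (i ℤ.+ j) ≈ fromℤ i + fromℤ j
  fromℤ-+ (+ m)    (+ n)    = ×-homo-+ 1# m n
  fromℤ-+ (+ m)    -[1+ n ] = fromℤ-⊖ m (suc n)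
  fromℤ-+ -[1+ m ] (+ n)    = trans (fromℤ-⊖ n (suc m)) (+-comm _ _)
  fromℤ-+ -[1+ m ] -[1+ n ] = begin
    - fromℕ (suc (suc (m ℕ.+ n)))       ≡⟨ ≡.cong (λ k → - fromℕ k) (ℕ.+-suc (suc m) n) ⟨
    - fromℕ (suc m ℕ.+ suc n)           ≈⟨ -‿cong (×-homo-+ 1# (suc m) (suc n)) ⟩
    - (fromℕ (suc m) + fromℕ (suc n))   ≈⟨ -‿+-comm _ _ ⟨
    - fromℕ (suc m) + - fromℕ (suc n)   ∎

  fromℤ-neg : ∀ i → fromℤ (ℤ.- i) ≈ - fromℤ i
  fromℤ-neg (+ zero)  = sym -0#≈0#
  fromℤ-neg (+ suc n) = refl
  fromℤ-neg -[1+ n ]  = sym (-‿involutive _)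

  fromℤ-+◃ : ∀ n → fromℤ (Sign.+ ◃ n) ≈ fromℕ n
  fromℤ-+◃ zero    = refl
  fromℤ-+◃ (suc n) = refl

  fromℤ--◃ : ∀ n → fromℤ (Sign.- ◃ n) ≈ - fromℕ n
  fromℤ--◃ zero    = sym -0#≈0#
  fromℤ--◃ (suc n) = refl

  fromℤ-* : ∀ i j → fromℤ (i ℤ.* j) ≈ fromℤ i * fromℤ j
  fromℤ-* (+ m) (+ n) = trans (fromℤ-+◃ (m ℕ.* n)) (×1-homo-* m n)
  fromℤ-* (+ m) -[1+ n ] = begin
    fromℤ (Sign.- ◃ m ℕ.* suc n)        ≈⟨ fromℤ--◃ (m ℕ.* suc n) ⟩
    - fromℕ (m ℕ.* suc n)               ≈⟨ -‿cong (×1-homo-* m (suc n)) ⟩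
    - (fromℕ m * fromℕ (suc n))         ≈⟨ -‿distribʳ-* _ _ ⟩
    fromℕ m * - fromℕ (suc n)           ∎
  fromℤ-* -[1+ m ] (+ n) = begin
    fromℤ (Sign.- ◃ suc m ℕ.* n)        ≈⟨ fromℤ--◃ (suc m ℕ.* n) ⟩
    - fromℕ (suc m ℕ.* n)               ≈⟨ -‿cong (×1-homo-* (suc m) n) ⟩
    - (fromℕ (suc m) * fromℕ n)         ≈⟨ -‿distribˡ-* _ _ ⟩
    - fromℕ (suc m) * fromℕ n           ∎
  fromℤ-* -[1+ m ] -[1+ n ] = begin
    fromℤ (Sign.+ ◃ suc m ℕ.* suc n)    ≈⟨ fromℤ-+◃ (suc m ℕ.* suc n) ⟩
    fromℕ (suc m ℕ.* suc n)             ≈⟨ ×1-homo-* (suc m) (suc n) ⟩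
    fromℕ (suc m) * fromℕ (suc n)       ≈⟨ -‿involutive _ ⟨
    - - (fromℕ (suc m) * fromℕ (suc n)) ≈⟨ -‿cong (-‿distribˡ-* _ _) ⟩
    - (- fromℕ (suc m) * fromℕ (suc n)) ≈⟨ -‿distribʳ-* _ _ ⟩
    - fromℕ (suc m) * - fromℕ (suc n)   ∎

  fromℤ-homomorphism : +-*-rawRing -Raw-AlmostCommutative⟶ fromCommutativeRing R
  fromℤ-homomorphism = record
    { ⟦_⟧    = fromℤ
    ; +-homo = fromℤ-+
    ; *-homo = fromℤ-*
    ; -‿homo = fromℤ-neg
    ; 0-homo = refl
    ; 1-homo = refl
    }

  fromℤ-≈? : ∀ i j → Maybe (fromℤ i ≈ fromℤ j)
  fromℤ-≈? i j with i ℤ.≟ j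
  ... | yes ≡.refl = just refl
  ... | no _       = nothing

  open import Algebra.Solver.Ring
    +-*-rawRing (fromCommutativeRing R) fromℤ-homomorphism fromℤ-≈? public

module FieldProperties {ℓ₁ ℓ₂} (F : Field ℓ₁ ℓ₂) where
  open Field F

  x*[y*y⁻¹]≈x : ∀ {y} → ¬ (y ≈ 0#) → ∀ x → x * (y * y ⁻¹) ≈ x
  x*[y*y⁻¹]≈x y≉0 x = trans (*-congˡ (*-inverseʳ _ y≉0)) (*-identityʳ x)

  x≈[x*y]/y : ∀ {y} → ¬ (y ≈ 0#) → ∀ x → x ≈ (x * y) / y
  x≈[x*y]/y {y} y≉0 x = sym (trans (*-assoc x y (y ⁻¹)) (x*[y*y⁻¹]≈x y≉0 x))

module SequenceProperties {ℓ₁ ℓ₂} (F : Field ℓ₁ ℓ₂) (a₀ b₀ c₀ d₀ : Field.Carrier F) where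
  open Field F
  open Seq F a₀ b₀ c₀ d₀
  open FieldProperties F
  open IntegerCoefficientRingSolver commutativeRing
  open import Relation.Binary.Reasoning.Setoid setoid

  αₙ βₙ : ℕ → Carrier
  αₙ n = a n * (c n + d n - a n)
  βₙ n = c n - (1# + 1#) * a n

  -- In the solver calls y stands for â n ⁻¹, and a′ c′ d′ for the step formulas
  -- of Seq.step; what remains is to cancel y against â n.
  βₙ-suc : ∀ n → ¬ (â n ≈ 0#) → βₙ (suc n) ≈ βₙ n
  βₙ-suc n â≉0 = begin
    βₙ (suc n)
      ≈⟨ solve 4 (λ a c d y →
           let a′ = (a :* a :- a :* c :- a :* d) :* y
               c′ = (a :* c :- con (+ 2) :* a :* d :- c :* c) :* y
           in c′ :- con (+ 2) :* a′ := (c :- con (+ 2) :* a) :* ((a :- c) :* y))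
         refl (a n) (c n) (d n) (â n ⁻¹) ⟩
    βₙ n * (â n * â n ⁻¹)
      ≈⟨ x*[y*y⁻¹]≈x â≉0 (βₙ n) ⟩
    βₙ n ∎

  αₙ-suc : ∀ n → ¬ (â n ≈ 0#) → αₙ (suc n) ≈ αₙ n
  αₙ-suc n â≉0 = begin
    αₙ (suc n)
      ≈⟨ solve 4 (λ a c d y →
           let a′ = (a :* a :- a :* c :- a :* d) :* y
               c′ = (a :* c :- con (+ 2) :* a :* d :- c :* c) :* y
               d′ = (a :* d) :* y
           in a′ :* (c′ :+ d′ :- a′) := a :* (c :+ d :- a) :* ((a :- c) :* y) :* ((a :- c) :* y))
         refl (a n) (c n) (d n) (â n ⁻¹) ⟩
    αₙ n * (â n * â n ⁻¹) * (â n * â n ⁻¹)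
      ≈⟨ *-congʳ (x*[y*y⁻¹]≈x â≉0 (αₙ n)) ⟩
    αₙ n * (â n * â n ⁻¹)
      ≈⟨ x*[y*y⁻¹]≈x â≉0 (αₙ n) ⟩
    αₙ n ∎

  a-suc*[c-a]≈αₙ : ∀ n → ¬ (â n ≈ 0#) → a (suc n) * (c n - a n) ≈ αₙ n
  a-suc*[c-a]≈αₙ n â≉0 = begin
    a (suc n) * (c n - a n)
      ≈⟨ solve 4 (λ a c d y →
           let a′ = (a :* a :- a :* c :- a :* d) :* y
           in a′ :* (c :- a) := a :* (c :+ d :- a) :* ((a :- c) :* y))
         refl (a n) (c n) (d n) (â n ⁻¹) ⟩
    αₙ n * (â n * â n ⁻¹)
      ≈⟨ x*[y*y⁻¹]≈x â≉0 (αₙ n) ⟩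
    αₙ n ∎

  c-a≈βₙ+a : ∀ n → c n - a n ≈ βₙ n + a n
  c-a≈βₙ+a n = solve 2 (λ a c → c :- a := (c :- con (+ 2) :* a) :+ a) refl (a n) (c n)

  ÂNonZeroBelow : ℕ → Set ℓ₂
  ÂNonZeroBelow m = ∀ k → k < m → ¬ (â k ≈ 0#)

  ÂNonZeroBelow-pred : ∀ {m} → ÂNonZeroBelow (suc m) → ÂNonZeroBelow m
  ÂNonZeroBelow-pred â≉0 k k<m = â≉0 k (ℕ.m<n⇒m<1+n k<m)

  stable⇒constant : (f : ℕ → Carrier) → (∀ k → ¬ (â k ≈ 0#) → f (suc k) ≈ f k) →
                    ∀ m → ÂNonZeroBelow m → f m ≈ f 0
  stable⇒constant f stable zero    _   = refl
  stable⇒constant f stable (suc m) â≉0 =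
    trans (stable m (â≉0 m ℕ.≤-refl)) (stable⇒constant f stable m (ÂNonZeroBelow-pred â≉0))

  [c-a]*B≈B-suc : ∀ m → ÂNonZeroBelow m → (c m - a m) * B m ≈ B (suc m)
  a-suc*B-suc≈α*B : ∀ m → ÂNonZeroBelow (suc m) → a (suc m) * B (suc m) ≈ α * B m

  [c-a]*B≈B-suc zero    _   = *-identityʳ _
  [c-a]*B≈B-suc (suc m) â≉0 = begin
    (c (suc m) - a (suc m)) * B (suc m)        ≈⟨ *-congʳ (c-a≈βₙ+a (suc m)) ⟩
    (βₙ (suc m) + a (suc m)) * B (suc m)       ≈⟨ *-congʳ (+-congʳ βₘ₊₁≈β) ⟩
    (β + a (suc m)) * B (suc m)                ≈⟨ distribʳ _ _ _ ⟩
    β * B (suc m) + a (suc m) * B (suc m)      ≈⟨ +-congˡ (a-suc*B-suc≈α*B m â≉0) ⟩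
    β * B (suc m) + α * B m                    ∎
    where
    βₘ₊₁≈β : βₙ (suc m) ≈ β
    βₘ₊₁≈β = stable⇒constant βₙ βₙ-suc (suc m) â≉0

  a-suc*B-suc≈α*B m â≉0 = begin
    a (suc m) * B (suc m)                      ≈⟨ *-congˡ ([c-a]*B≈B-suc m â≉0-below-m) ⟨
    a (suc m) * ((c m - a m) * B m)            ≈⟨ *-assoc _ _ _ ⟨
    a (suc m) * (c m - a m) * B m              ≈⟨ *-congʳ (a-suc*[c-a]≈αₙ m (â≉0 m ℕ.≤-refl)) ⟩
    αₙ m * B m                                 ≈⟨ *-congʳ (stable⇒constant αₙ αₙ-suc m â≉0-below-m) ⟩
    α * B m                                    ∎
    where
    â≉0-below-m : ÂNonZeroBelow m
    â≉0-below-m = ÂNonZeroBelow-pred â≉0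

corollary7 : ∀ {ℓ₁ ℓ₂} (F : Field ℓ₁ ℓ₂) (a₀ b₀ c₀ d₀ : Field.Carrier F) (n : ℕ) →
    let open Field F in let open Seq F a₀ b₀ c₀ d₀ in
    (∀ k → k ≤ n → ¬ (a k ≈ 0#)) →
    (∀ k → k ≤ n → ¬ (â k ≈ 0#)) →
    (∀ k → 1 ≤ k → k ≤ suc n → ¬ (B k ≈ 0#)) →
    (a (suc n) ≈ (α * B n) / B (suc n)) × (â (suc n) ≈ - (B (suc (suc n)) / B (suc n)))
corollary7 F a₀ b₀ c₀ d₀ n _ â≉0 B≉0 = a-formula , â-formula
  where
  open Field F
  open Seq F a₀ b₀ c₀ d₀
  open FieldProperties F
  open SequenceProperties F a₀ b₀ c₀ d₀
  open import Algebra.Properties.Ring ring using (⁻¹-anti-homo‿-)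
  open import Relation.Binary.Reasoning.Setoid setoid

  â≉0-below : ÂNonZeroBelow (suc n)
  â≉0-below k k<1+n = â≉0 k (ℕ.≤-pred k<1+n)

  B-suc≉0 : ¬ (B (suc n) ≈ 0#)
  B-suc≉0 = B≉0 (suc n) (s≤s z≤n) ℕ.≤-refl

  a-formula : a (suc n) ≈ (α * B n) / B (suc n)
  a-formula = begin
    a (suc n)                                  ≈⟨ x≈[x*y]/y B-suc≉0 (a (suc n)) ⟩
    (a (suc n) * B (suc n)) / B (suc n)        ≈⟨ *-congʳ (a-suc*B-suc≈α*B n â≉0-below) ⟩
    (α * B n) / B (suc n)                      ∎

  â-formula : â (suc n) ≈ - (B (suc (suc n)) / B (suc n))
  â-formula = begin
    â (suc n)                                  ≈⟨ ⁻¹-anti-homo‿- (c (suc n)) (a (suc n)) ⟨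
    - (c (suc n) - a (suc n))                  ≈⟨ -‿cong (x≈[x*y]/y B-suc≉0 _) ⟩
    - ((c (suc n) - a (suc n)) * B (suc n) / B (suc n))
      ≈⟨ -‿cong (*-congʳ ([c-a]*B≈B-suc (suc n) â≉0-below)) ⟩
    - (B (suc (suc n)) / B (suc n))            ∎
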